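{- Let $\mathbf{M}=(M;\le,0,1)$ be a non-trivial complete lattice, let $S$ and $X$ be non-empty sets, and let $\mathbf{B}=(B;\le,0,1)$ be a bounded subposet of $\mathbf{M}^{S}$. Let $P=(P_x)_{x\in X}\colon B\to (M^{S})^{X}$ and $T=(T_x)_{x\in X}\colon B\to (M^{S})^{X}$ be order-preserving maps such that for all $a,b\in B$ and all $x\in X$, $$P_x(a)\le b \iff a\le T_x(b).$$ Let $R_T\subseteq X\times S\times S$ and $R^{P}\subseteq X\times S\times S$ be the upper $T$-induced and lower $P$-induced state-transition relations. Then: (a) If $P_x(b)\in B$ for all $x\in X$ and $b\in B$, then $R_T\subseteq R^{P}$. (b) If $T_x(b)\in B$ for all $x\in X$ and $b\in B$, then $R^{P}\subseteq R_T$. (c) If both $P_x(b)\in B$ and $T_x(b)\in B$ for all $x\in X$ and $b\in B$, then $R_T=R^{P}$, i.e. the upper $T$-induced automaton $(X,S,R_T)$ equals the lower $P$-induced automaton $(X,S,R^{P})$.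
   Context: $\mathbf{M}^S$ is the set of all maps $S\to M$ ordered pointwise; a bounded subposet $\mathbf{B}$ of $\mathbf{M}^S$ is a subset containing the constant maps $0$ and $1$, with the induced order. For $p\in M^S$ and $s\in S$, $p(s)$ denotes the value of $p$ at $s$. For each $x\in X$ define the relations on $S$ $$R_{T_x}=\{(s,t)\in S\times S\mid \forall b\in B:\ T_x(b)(s)\le b(t)\},\qquad R^{P_x}=\{(s,t)\in S\times S\mid \forall a\in B:\ a(s)\le P_x(a)(t)\}.$$ The upper $T$-induced state-transition relation is $R_T=\bigcup_{x\in X}\{x\}\times R_{T_x}$ and the lower $P$-induced state-transition relation is $R^{P}=\bigcup_{x\in X}\{x\}\times R^{P_x}$. An automaton is a triple $(X,S,R)$ with $R\subseteq X\times S\times S$. -}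

module Defs where

open import Level using (Level; _⊔_; suc)
open import Data.Product using (Σ; _×_; _,_; proj₁)
open import Data.Empty.Polymorphic using (⊥)
open import Relation.Nullary using (¬_)
open import Relation.Unary using (Pred)
open import Relation.Binary.Bundles using (Poset)

record IsCompleteLattice {c ℓ₁ ℓ₂} (M : Poset c ℓ₁ ℓ₂) (ℓ : Level)
       : Set (c ⊔ ℓ₁ ⊔ ℓ₂ ⊔ suc ℓ) where
  open Poset M
  field
    ⋁ : Pred Carrier ℓ → Carrier
    ⋁-upper : ∀ A x → A x → x ≤ ⋁ A
    ⋁-least : ∀ A y → (∀ x → A x → x ≤ y) → ⋁ A ≤ y
    ⋀ : Pred Carrier ℓ → Carrier
    ⋀-lower : ∀ A x → A x → ⋀ A ≤ x
    ⋀-greatest : ∀ A y → (∀ x → A x → y ≤ x) → y ≤ ⋀ A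

  𝟘 : Carrier
  𝟘 = ⋁ (λ _ → ⊥)
  𝟙 : Carrier
  𝟙 = ⋀ (λ _ → ⊥)

  NonTrivial : Set ℓ₁
  NonTrivial = ¬ (𝟘 ≈ 𝟙)

module _ {c ℓ₁ ℓ₂} (M : Poset c ℓ₁ ℓ₂) where
  open Poset M

  _≤ᵖ_ : {s : Level} {S : Set s} → (S → Carrier) → (S → Carrier) → Set (s ⊔ ℓ₂)
  p ≤ᵖ q = ∀ i → p i ≤ q i

  El : {s ℓB : Level} {S : Set s} → Pred (S → Carrier) ℓB → Set (c ⊔ s ⊔ ℓB)
  El {S = S} B = Σ (S → Carrier) B

  UpperRel : {s x ℓB : Level} {S : Set s} {X : Set x} (B : Pred (S → Carrier) ℓB)
             (T : X → El B → (S → Carrier)) → X → S → S → Set (c ⊔ s ⊔ ℓB ⊔ ℓ₂)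
  UpperRel B T x s t = ∀ (b : El B) → T x b s ≤ proj₁ b t

  LowerRel : {s x ℓB : Level} {S : Set s} {X : Set x} (B : Pred (S → Carrier) ℓB)
             (P : X → El B → (S → Carrier)) → X → S → S → Set (c ⊔ s ⊔ ℓB ⊔ ℓ₂)
  LowerRel B P x s t = ∀ (a : El B) → proj₁ a s ≤ P x a t

_⊆₃_ : {a b c ℓ ℓ' : Level} {A : Set a} {B : Set b} {C : Set c} →
       (A → B → C → Set ℓ) → (A → B → C → Set ℓ') → Set (a ⊔ b ⊔ c ⊔ ℓ ⊔ ℓ')
R ⊆₃ R' = ∀ x s t → R x s t → R' x s t

module Submission where

open import Defs
open import Level using (Level)
open import Data.Product using (_×_; _,_; proj₁)
open import Relation.Unary using (Pred)
open import Relation.Binary.Bundles using (Poset)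
open import Function.Bundles using (_⇔_; Equivalence)

-- Both inclusions come from the unit a ≤ T_x(P_x a) and counit P_x(T_x b) ≤ b of the
-- Galois connection P_x ⊣ T_x; they are only available as instances of the quantifiers
-- over B when P_x a (resp. T_x b) lies in B.
module _ {c ℓ₁ ℓ₂ s x ℓB : Level} (M : Poset c ℓ₁ ℓ₂) {S : Set s} {X : Set x}
         {B : Pred (S → Poset.Carrier M) ℓB} (P T : X → El M B → (S → Poset.Carrier M))
         (adj : ∀ x a b → _≤ᵖ_ M (P x a) (proj₁ b) ⇔ _≤ᵖ_ M (proj₁ a) (T x b))
  where
  open Poset M

  unit : ∀ x a → (PaB : B (P x a)) → _≤ᵖ_ M (proj₁ a) (T x (P x a , PaB))
  unit x a PaB = Equivalence.to (adj x a (P x a , PaB)) (λ _ → refl)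

  counit : ∀ x b → (TbB : B (T x b)) → _≤ᵖ_ M (P x (T x b , TbB)) (proj₁ b)
  counit x b TbB = Equivalence.from (adj x (T x b , TbB) b) (λ _ → refl)

  upperRel⊆lowerRel : (∀ x b → B (P x b)) → UpperRel M B T ⊆₃ LowerRel M B P
  upperRel⊆lowerRel PB x s t sRt a = trans (unit x a (PB x a) s) (sRt (P x a , PB x a))

  lowerRel⊆upperRel : (∀ x b → B (T x b)) → LowerRel M B P ⊆₃ UpperRel M B T
  lowerRel⊆upperRel TB x s t sRt b = trans (sRt (T x b , TB x b)) (counit x b (TB x b) t)

theorem2 : ∀ {c ℓ₁ ℓ₂ ℓ s x ℓB : Level} (M : Poset c ℓ₁ ℓ₂) (CL : IsCompleteLattice M ℓ) →
    IsCompleteLattice.NonTrivial CL →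
    (S : Set s) → S → (X : Set x) → X →
    (B : Pred (S → Poset.Carrier M) ℓB) →
    B (λ _ → IsCompleteLattice.𝟘 CL) → B (λ _ → IsCompleteLattice.𝟙 CL) →
    (P T : X → El M B → (S → Poset.Carrier M)) →
    (∀ x a b → _≤ᵖ_ M (proj₁ a) (proj₁ b) → _≤ᵖ_ M (P x a) (P x b)) →
    (∀ x a b → _≤ᵖ_ M (proj₁ a) (proj₁ b) → _≤ᵖ_ M (T x a) (T x b)) →
    (∀ x a b → _≤ᵖ_ M (P x a) (proj₁ b) ⇔ _≤ᵖ_ M (proj₁ a) (T x b)) →
    ((∀ x b → B (P x b)) → UpperRel M B T ⊆₃ LowerRel M B P)
    × ((∀ x b → B (T x b)) → LowerRel M B P ⊆₃ UpperRel M B T)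
    × ((∀ x b → B (P x b)) → (∀ x b → B (T x b)) →
    (UpperRel M B T ⊆₃ LowerRel M B P) × (LowerRel M B P ⊆₃ UpperRel M B T))
theorem2 M _ _ _ _ _ _ _ _ _ P T _ _ adj =
  upperRel⊆lowerRel M P T adj ,
  lowerRel⊆upperRel M P T adj ,
  λ PB TB → upperRel⊆lowerRel M P T adj PB , lowerRel⊆upperRel M P T adj TB
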